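{- For integers $k\ge \ell\ge 2$, $a_{k,\ell}\neq \frac{1}{\ell}$.
   Context: Let $H_{n,k}=\{0,1,\dots,n-1\}^k$. For $\ell\le k$, an $\ell$-rook is a point $P\in H_{n,k}$ together with a set $D$ of $\ell$ of the $k$ coordinate indices; it covers $P$ itself and every point of $H_{n,k}$ which differs from $P$ in exactly one coordinate, that coordinate belonging to $D$. Distinct rooks must occupy distinct points. $a_{n,k,\ell}$ is the minimum number of $\ell$-rooks whose covered sets together cover $H_{n,k}$, and $a_{k,\ell}=\lim_{n\to\infty} a_{n,k,\ell}/n^{k-1}$ (this limit exists). -}

module Defs where

open import Data.Nat using (ℕ; zero; suc; _∸_; _^_; _<_; _≥_)
open import Data.Nat.Properties using (m^n≢0)
open import Data.Integer using (+_)
open import Data.Rational using (ℚ; _/_; _-_; ∣_∣) renaming (_<_ to _<ℚ_; _>_ to _>ℚ_)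
open import Data.Rational using (0ℚ)
open import Data.Fin using (Fin)
open import Data.Fin.Subset using (Subset; _∈_) renaming (∣_∣ to size)
open import Data.Product using (Σ; ∃; _×_)
open import Data.Sum using (_⊎_)
open import Relation.Binary.PropositionalEquality using (_≡_; _≢_)
open import Relation.Nullary using (¬_)

Point : ℕ → ℕ → Set
Point n k = Fin k → Fin n

SamePoint : ∀ {n k} → Point n k → Point n k → Set
SamePoint P Q = ∀ c → P c ≡ Q c

record Rook (n k ℓ : ℕ) : Set where
  field
    pos  : Point n k
    dirs : Subset k
    dirs-size : size dirs ≡ ℓ
open Rook public

Covers : ∀ {n k ℓ} → Rook n k ℓ → Point n k → Set
Covers {n} {k} r Q =
  SamePoint (pos r) Q ⊎
  Σ (Fin k) λ i → (i ∈ dirs r) × (pos r i ≢ Q i) × (∀ j → j ≢ i → pos r j ≡ Q j)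

HasCover : ℕ → ℕ → ℕ → ℕ → Set
HasCover n k ℓ m =
  Σ (Fin m → Rook n k ℓ) λ rooks →
    (∀ i j → SamePoint (pos (rooks i)) (pos (rooks j)) → i ≡ j) ×
    (∀ (Q : Point n k) → ∃ λ i → Covers (rooks i) Q)

-- m is the minimum number of ℓ-rooks covering H_{n,k}, i.e. m = a_{n,k,ℓ}.
IsMinCover : ℕ → ℕ → ℕ → ℕ → Set
IsMinCover n k ℓ m = HasCover n k ℓ m × (∀ m′ → m′ < m → ¬ HasCover n k ℓ m′)

-- The ratio m / n^{k-1} for n = suc n′ ≥ 1.
ratio : ℕ → ℕ → ℕ → ℚ
ratio n′ k m = _/_ (+ m) (suc n′ ^ (k ∸ 1)) {{m^n≢0 (suc n′) (k ∸ 1)}}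

-- The sequence a_{n,k,ℓ} / n^{k-1} converges (as n → ∞) to the rational L.
ConvergesTo : ℕ → ℕ → ℚ → Set
ConvergesTo k ℓ L =
  ∀ (ε : ℚ) → ε >ℚ 0ℚ →
    ∃ λ N → ∀ n′ → suc n′ ≥ N → ∀ m → IsMinCover (suc n′) k ℓ m →
      ∣ ratio n′ k m - L ∣ <ℚ ε

-- The rational 1/ℓ (only used for ℓ ≥ 2; the value at ℓ = 0 is irrelevant).
oneOver : ℕ → ℚ
oneOver zero    = 0ℚ
oneOver (suc l) = (+ 1) / suc l

-- Give every rook r and every direction i in its set D r the i-line through its position.
-- Counting incidences between points and these lines, n·m·ℓ = n^k + W, where the
-- overcount W sums coverage(Y) − 1 over all points Y.  Now fix directions i ≠ j and call
-- a rook using both a cross.  In an i–j plane an i-line and a j-line always meet, so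
-- summing the overcount along i-lines shows that the crosses whose plane holds at least
-- t crosses force an overcount of at least t each, while the planes holding fewer than
-- t crosses contain at most t·n^(k-2) crosses altogether.  Since every rook is a cross for
-- ℓ(ℓ-1) ≥ ℓ ordered pairs (i, j), taking t = n/T with T = 2k² gives W ≥ n^k/T²,
-- i.e. m·ℓ/n^(k-1) ≥ 1 + 1/T².  Along n ∈ T·ℕ the ratio a_{n,k,ℓ}/n^(k-1) therefore
-- stays at least 1/(T²ℓ) above 1/ℓ.

module Submission where

open import Defs

open import Data.Bool using (Bool; true; false; _∧_; _∨_; not)
open import Data.Bool.Properties using (∧-conicalˡ; ∧-conicalʳ; ∧-idem)
open import Data.Fin using (Fin; zero; suc; _≟_; combine; finToFun; funToFin)
open import Data.Fin.Properties using (funToFin-finToFin; finToFun-funToFin)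
open import Data.Fin.Subset using (Subset; ⊤; ⁅_⁆; _∪_; _∩_; _⊆_; ∣_∣)
open import Data.Fin.Subset.Properties
  using (∣⊥∣≡0; ∣⁅x⁆∣≡1; x∈⁅x⁆; ∪-zeroʳ; ∩-identityʳ; ∪-identityˡ; ∪-identityʳ; ∩-zeroˡ; ∩-zeroʳ;
         drop-∷-⊆; ⊆-refl; p⊆p∪q)
import Data.Integer as ℤ
import Data.Integer.Properties as ℤ
open import Data.Integer.Tactic.RingSolver renaming (solve-∀ to ℤ-solve-∀)
open import Data.Nat hiding (_≟_)
open import Data.Nat.Properties hiding (_≟_)
open import Data.Nat.Tactic.RingSolver using (solve-∀)
open import Algebra.Properties.CommutativeSemigroup *-commutativeSemigroup
  using (interchange; x∙yz≈y∙xz; xy∙z≈y∙xz; xy∙z≈xz∙y)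
open import Algebra.Properties.Semiring.Sum +-*-semiring
  using (sum; sum-syntax; sum-cong-≗; ∑-distrib-+; ∑-comm; *-distribˡ-sum; *-distribʳ-sum)
open import Data.Product using (Σ; _×_; _,_; proj₁; proj₂)
open import Data.Rational using (0ℚ)
import Data.Rational as ℚ
import Data.Rational.Properties as ℚ
import Data.Rational.Unnormalised as ℚᵘ
import Data.Rational.Unnormalised.Properties as ℚᵘ
open import Data.Sum using (inj₁; inj₂)
open import Data.Vec using (Vec; []; _∷_; lookup; tabulate; here)
open import Data.Vec.Properties using ([]=⇒lookup; lookup∘tabulate)
open import Function using (_∘_)
open import Relation.Binary.PropositionalEquality
open import Relation.Nullary using (¬_; contradiction; yes; no)
open import Relation.Nullary.Decidable using (does; dec-true)
open import Relation.Nullary.Reflects using (ofʸ; ofⁿ)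

-- Sums over Fin n and over the cube H_{n,k}

∑-mono : ∀ {n} {f g : Fin n → ℕ} → (∀ i → f i ≤ g i) → ∑[ i < n ] f i ≤ ∑[ i < n ] g i
∑-mono {zero}  f≤g = z≤n
∑-mono {suc n} f≤g = +-mono-≤ (f≤g zero) (∑-mono (λ i → f≤g (suc i)))

∑-const : ∀ n c → ∑[ i < n ] c ≡ n * c
∑-const zero    c = refl
∑-const (suc n) c = cong (c +_) (∑-const n c)

term≤∑ : ∀ {n} (f : Fin n → ℕ) i → f i ≤ ∑[ j < n ] f j
term≤∑ f zero    = m≤m+n _ _
term≤∑ f (suc i) = ≤-trans (term≤∑ (λ j → f (suc j)) i) (m≤n+m _ _)

distinct-terms≤∑ : ∀ {n} (f : Fin n → ℕ) {i j} → i ≢ j → f i + f j ≤ ∑[ l < n ] f l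
distinct-terms≤∑ f {zero}  {zero}  i≢j = contradiction refl i≢j
distinct-terms≤∑ f {zero}  {suc j} i≢j = +-monoʳ-≤ (f zero) (term≤∑ (λ l → f (suc l)) j)
distinct-terms≤∑ f {suc i} {zero}  i≢j =
  subst (_≤ sum f) (+-comm (f zero) (f (suc i))) (+-monoʳ-≤ (f zero) (term≤∑ (λ l → f (suc l)) i))
distinct-terms≤∑ f {suc i} {suc j} i≢j =
  ≤-trans (distinct-terms≤∑ (λ l → f (suc l)) (i≢j ∘ cong suc)) (m≤n+m _ (f zero))

∑ᴴ : ∀ {n k} → (Vec (Fin n) k → ℕ) → ℕ
∑ᴴ {k = zero}      f = f []
∑ᴴ {n} {k = suc k} f = ∑[ y < n ] ∑ᴴ (λ Y → f (y ∷ Y))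

∑ᴴ-cong : ∀ {n k} {f g : Vec (Fin n) k → ℕ} → (∀ X → f X ≡ g X) → ∑ᴴ f ≡ ∑ᴴ g
∑ᴴ-cong {k = zero}  f≗g = f≗g []
∑ᴴ-cong {n} {suc k} f≗g = sum-cong-≗ {n} (λ y → ∑ᴴ-cong (λ Y → f≗g (y ∷ Y)))

∑ᴴ-mono : ∀ {n k} {f g : Vec (Fin n) k → ℕ} → (∀ X → f X ≤ g X) → ∑ᴴ f ≤ ∑ᴴ g
∑ᴴ-mono {k = zero}  f≤g = f≤g []
∑ᴴ-mono {k = suc k} f≤g = ∑-mono (λ y → ∑ᴴ-mono (λ Y → f≤g (y ∷ Y)))

∑ᴴ-distrib-+ : ∀ {n k} (f g : Vec (Fin n) k → ℕ) → ∑ᴴ (λ X → f X + g X) ≡ ∑ᴴ f + ∑ᴴ g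
∑ᴴ-distrib-+ {k = zero}  f g = refl
∑ᴴ-distrib-+ {n} {suc k} f g =
  trans (sum-cong-≗ {n} (λ y → ∑ᴴ-distrib-+ (λ Y → f (y ∷ Y)) (λ Y → g (y ∷ Y)))) (∑-distrib-+ {n} _ _)

*-distribˡ-∑ᴴ : ∀ {n k} c (f : Vec (Fin n) k → ℕ) → c * ∑ᴴ f ≡ ∑ᴴ (λ X → c * f X)
*-distribˡ-∑ᴴ {k = zero}  c f = refl
*-distribˡ-∑ᴴ {n} {suc k} c f =
  trans (*-distribˡ-sum {n} c _) (sum-cong-≗ {n} (λ y → *-distribˡ-∑ᴴ c (λ Y → f (y ∷ Y))))

*-distribʳ-∑ᴴ : ∀ {n k} c (f : Vec (Fin n) k → ℕ) → ∑ᴴ f * c ≡ ∑ᴴ (λ X → f X * c)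
*-distribʳ-∑ᴴ c f =
  trans (*-comm _ c) (trans (*-distribˡ-∑ᴴ c f) (∑ᴴ-cong (λ X → *-comm c (f X))))

∑ᴴ-const : ∀ n k c → ∑ᴴ {n} {k} (λ _ → c) ≡ n ^ k * c
∑ᴴ-const n zero    c = sym (+-identityʳ c)
∑ᴴ-const n (suc k) c = begin
  ∑[ y < n ] ∑ᴴ {n} {k} (λ _ → c) ≡⟨ sum-cong-≗ {n} (λ _ → ∑ᴴ-const n k c) ⟩
  ∑[ y < n ] (n ^ k * c)          ≡⟨ ∑-const n _ ⟩
  n * (n ^ k * c)                 ≡⟨ *-assoc n (n ^ k) c ⟨
  n ^ suc k * c                   ∎
  where open ≡-Reasoning

∑ᴴ-∑-comm : ∀ {n k m} (f : Vec (Fin n) k → Fin m → ℕ) →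
            ∑ᴴ (λ X → ∑[ r < m ] f X r) ≡ ∑[ r < m ] ∑ᴴ (λ X → f X r)
∑ᴴ-∑-comm {k = zero}  f = refl
∑ᴴ-∑-comm {n} {suc k} {m} f =
  trans (sum-cong-≗ {n} (λ y → ∑ᴴ-∑-comm (λ Y → f (y ∷ Y)))) (∑-comm {n} {m} _)

∑ᴴ-comm : ∀ {n k k′} (f : Vec (Fin n) k → Vec (Fin n) k′ → ℕ) →
          ∑ᴴ (λ X → ∑ᴴ (λ Y → f X Y)) ≡ ∑ᴴ (λ Y → ∑ᴴ (λ X → f X Y))
∑ᴴ-comm {k = zero}  f = refl
∑ᴴ-comm {n} {suc k} f =
  trans (sum-cong-≗ {n} (λ x → ∑ᴴ-comm (λ X Y → f (x ∷ X) Y)))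
        (sym (∑ᴴ-∑-comm (λ Y x → ∑ᴴ (λ X → f (x ∷ X) Y))))

-- Indicators and flats

𝟙 : Bool → ℕ
𝟙 true  = 1
𝟙 false = 0

𝟙≤1 : ∀ b → 𝟙 b ≤ 1
𝟙≤1 true  = ≤-refl
𝟙≤1 false = z≤n

𝟙-∧≤ʳ : ∀ a b → 𝟙 (a ∧ b) ≤ 𝟙 b
𝟙-∧≤ʳ true  b = ≤-refl
𝟙-∧≤ʳ false b = z≤n

𝟙-∧ : ∀ a b → 𝟙 (a ∧ b) ≡ 𝟙 a * 𝟙 b
𝟙-∧ true  b = sym (+-identityʳ _)
𝟙-∧ false b = refl

∣∷∣ : ∀ {k} b (p : Subset k) → ∣ b ∷ p ∣ ≡ 𝟙 b + ∣ p ∣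
∣∷∣ true  p = refl
∣∷∣ false p = refl

∣p∣≡∑𝟙 : ∀ {k} (p : Subset k) → ∣ p ∣ ≡ ∑[ i < k ] 𝟙 (lookup p i)
∣p∣≡∑𝟙 []      = refl
∣p∣≡∑𝟙 (b ∷ p) = trans (∣∷∣ b p) (cong (𝟙 b +_) (∣p∣≡∑𝟙 p))

∑-𝟙≟ : ∀ {n} (x : Fin n) (g : Fin n → ℕ) → ∑[ y < n ] (𝟙 (does (x ≟ y)) * g y) ≡ g x
∑-𝟙≟ {suc n} zero    g = begin
  g zero + 0 + ∑[ y < n ] 0 ≡⟨ cong (g zero + 0 +_) (∑-const n 0) ⟩
  g zero + 0 + n * 0        ≡⟨ cong (g zero + 0 +_) (*-zeroʳ n) ⟩
  g zero + 0 + 0            ≡⟨ +-identityʳ _ ⟩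
  g zero + 0                ≡⟨ +-identityʳ _ ⟩
  g zero                    ∎
  where open ≡-Reasoning
∑-𝟙≟ {suc n} (suc x) g = ∑-𝟙≟ {n} x (λ y → g (suc y))

does-≟-sym : ∀ {n} (x y : Fin n) → does (x ≟ y) ≡ does (y ≟ x)
does-≟-sym x y with x ≟ y | y ≟ x
... | yes _   | yes _   = refl
... | no  _   | no  _   = refl
... | yes x≡y | no  y≢x = contradiction (sym x≡y) y≢x
... | no  x≢y | yes y≡x = contradiction (sym y≡x) x≢y

inFlat : ∀ {n k} → Subset k → Vec (Fin n) k → Vec (Fin n) k → Bool
inFlat []      []      []      = true
inFlat (d ∷ M) (x ∷ X) (y ∷ Y) = (d ∨ does (x ≟ y)) ∧ inFlat M X Y

inFlat-sym : ∀ {n k} (M : Subset k) (X Y : Vec (Fin n) k) → inFlat M X Y ≡ inFlat M Y X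
inFlat-sym []      []      []      = refl
inFlat-sym (d ∷ M) (x ∷ X) (y ∷ Y) = cong₂ (λ b c → (d ∨ b) ∧ c) (does-≟-sym x y) (inFlat-sym M X Y)

inFlat-⊤ : ∀ {n k} (X Y : Vec (Fin n) k) → inFlat ⊤ X Y ≡ true
inFlat-⊤ []      []      = refl
inFlat-⊤ (x ∷ X) (y ∷ Y) = inFlat-⊤ X Y

inFlat-coarsen : ∀ {n k} {M′ M : Subset k} → M′ ⊆ M → (Z : Vec (Fin n) k) {X Y : Vec (Fin n) k} →
                 inFlat M′ X Y ≡ true → inFlat M Z X ≡ inFlat M Z Y
inFlat-coarsen {M′ = []}     {[]}    _     []      {[]}    {[]}    _ = refl
inFlat-coarsen {M′ = d′ ∷ M′} {d ∷ M} M′⊆M (z ∷ Z) {x ∷ X} {y ∷ Y} XY∈M′ =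
  cong₂ _∧_ (coordinate d′ d (∧-conicalˡ _ _ XY∈M′) (λ d′≡true → head-⊆ d′≡true))
            (inFlat-coarsen (drop-∷-⊆ M′⊆M) Z (∧-conicalʳ _ _ XY∈M′))
  where
  head-⊆ : d′ ≡ true → d ≡ true
  head-⊆ refl with M′⊆M here
  ... | here = refl
  coordinate : ∀ d′ d → d′ ∨ does (x ≟ y) ≡ true → (d′ ≡ true → d ≡ true) →
               d ∨ does (z ≟ x) ≡ d ∨ does (z ≟ y)
  coordinate d′     true  _ _ = refl
  coordinate true   false _ d′⊆d with d′⊆d refl
  ... | ()
  coordinate false  false x≟y _ with x ≟ y | x≟y
  ... | yes refl | _  = refl
  ... | no  _    | ()

coordinate-intersection-size : ∀ {n} d d′ (x p : Fin n) →
  ∑[ y < n ] (𝟙 (d ∨ does (x ≟ y)) * 𝟙 (d′ ∨ does (p ≟ y)))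
    ≡ 𝟙 ((d ∨ d′) ∨ does (x ≟ p)) * n ^ 𝟙 (d ∧ d′)
coordinate-intersection-size {n} true  true  x p = trans (∑-const n 1) (sym (+-identityʳ _))
coordinate-intersection-size {n} true  false x p =
  trans (sum-cong-≗ {n} (λ y → *-comm 1 (𝟙 (does (p ≟ y))))) (∑-𝟙≟ p (λ _ → 1))
coordinate-intersection-size {n} false true  x p = ∑-𝟙≟ x (λ _ → 1)
coordinate-intersection-size {n} false false x p =
  trans (∑-𝟙≟ x (λ y → 𝟙 (does (p ≟ y)))) (trans (cong 𝟙 (does-≟-sym p x)) (sym (*-identityʳ _)))

flat-intersection-size : ∀ {n k} (M M′ : Subset k) (X P : Vec (Fin n) k) →
  ∑ᴴ (λ Y → 𝟙 (inFlat M X Y) * 𝟙 (inFlat M′ P Y)) ≡ 𝟙 (inFlat (M ∪ M′) X P) * n ^ ∣ M ∩ M′ ∣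
flat-intersection-size []      []        []      []      = refl
flat-intersection-size {n} {suc k} (d ∷ M) (d′ ∷ M′) (x ∷ X) (p ∷ P) = begin
  ∑[ y < n ] ∑ᴴ (λ Y → 𝟙 ((d ∨ does (x ≟ y)) ∧ inFlat M X Y) * 𝟙 ((d′ ∨ does (p ≟ y)) ∧ inFlat M′ P Y))
    ≡⟨ sum-cong-≗ {n} (λ y → ∑ᴴ-cong (λ Y → 𝟙-∧-interchange (d ∨ does (x ≟ y)) (inFlat M X Y) _ _)) ⟩
  ∑[ y < n ] ∑ᴴ (λ Y → line y * rest Y)
    ≡⟨ sum-cong-≗ {n} (λ y → *-distribˡ-∑ᴴ (line y) rest) ⟨
  ∑[ y < n ] (line y * ∑ᴴ rest)
    ≡⟨ *-distribʳ-sum {n} (∑ᴴ rest) line ⟨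
  (∑[ y < n ] line y) * ∑ᴴ rest
    ≡⟨ cong₂ _*_ (coordinate-intersection-size d d′ x p) (flat-intersection-size M M′ X P) ⟩
  (𝟙 a * n ^ 𝟙 (d ∧ d′)) * (𝟙 b * n ^ ∣ M ∩ M′ ∣)
    ≡⟨ interchange (𝟙 a) _ (𝟙 b) _ ⟩
  (𝟙 a * 𝟙 b) * (n ^ 𝟙 (d ∧ d′) * n ^ ∣ M ∩ M′ ∣)
    ≡⟨ cong₂ _*_ (𝟙-∧ a b) (^-distribˡ-+-* n (𝟙 (d ∧ d′)) ∣ M ∩ M′ ∣) ⟨
  𝟙 (a ∧ b) * n ^ (𝟙 (d ∧ d′) + ∣ M ∩ M′ ∣)
    ≡⟨ cong (λ e → 𝟙 (a ∧ b) * n ^ e) (∣∷∣ (d ∧ d′) (M ∩ M′)) ⟨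
  𝟙 (a ∧ b) * n ^ ∣ (d ∧ d′) ∷ M ∩ M′ ∣
    ∎
  where
  open ≡-Reasoning
  line : Fin n → ℕ
  line y = 𝟙 (d ∨ does (x ≟ y)) * 𝟙 (d′ ∨ does (p ≟ y))
  rest : Vec (Fin n) k → ℕ
  rest Y = 𝟙 (inFlat M X Y) * 𝟙 (inFlat M′ P Y)
  a b : Bool
  a = (d ∨ d′) ∨ does (x ≟ p)
  b = inFlat (M ∪ M′) X P
  𝟙-∧-interchange : ∀ a b c d → 𝟙 (a ∧ b) * 𝟙 (c ∧ d) ≡ (𝟙 a * 𝟙 c) * (𝟙 b * 𝟙 d)
  𝟙-∧-interchange a b c d rewrite 𝟙-∧ a b | 𝟙-∧ c d = interchange (𝟙 a) (𝟙 b) (𝟙 c) (𝟙 d)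

flat-size : ∀ {n k} (M : Subset k) (X : Vec (Fin n) k) → ∑ᴴ (λ Y → 𝟙 (inFlat M X Y)) ≡ n ^ ∣ M ∣
flat-size {n} M X = begin
  ∑ᴴ (λ Y → 𝟙 (inFlat M X Y))
    ≡⟨ ∑ᴴ-cong (λ Y → sym (*-identityʳ (𝟙 (inFlat M X Y)))) ⟩
  ∑ᴴ (λ Y → 𝟙 (inFlat M X Y) * 1)
    ≡⟨ ∑ᴴ-cong (λ Y → cong (λ b → 𝟙 (inFlat M X Y) * 𝟙 b) (inFlat-⊤ X Y)) ⟨
  ∑ᴴ (λ Y → 𝟙 (inFlat M X Y) * 𝟙 (inFlat ⊤ X Y))
    ≡⟨ flat-intersection-size M ⊤ X X ⟩
  𝟙 (inFlat (M ∪ ⊤) X X) * n ^ ∣ M ∩ ⊤ ∣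
    ≡⟨ cong₂ (λ p q → 𝟙 (inFlat p X X) * n ^ ∣ q ∣) (∪-zeroʳ M) (∩-identityʳ M) ⟩
  𝟙 (inFlat ⊤ X X) * n ^ ∣ M ∣
    ≡⟨ cong (λ b → 𝟙 b * n ^ ∣ M ∣) (inFlat-⊤ X X) ⟩
  1 * n ^ ∣ M ∣
    ≡⟨ *-identityˡ _ ⟩
  n ^ ∣ M ∣ ∎
  where open ≡-Reasoning

inFlat-intro : ∀ {n k} (M : Subset k) (X Y : Vec (Fin n) k) →
               (∀ c → lookup M c ≡ false → lookup X c ≡ lookup Y c) → inFlat M X Y ≡ true
inFlat-intro []      []      []      _     = refl
inFlat-intro (d ∷ M) (x ∷ X) (y ∷ Y) agree =
  cong₂ _∧_ (coordinate d (agree zero)) (inFlat-intro M X Y (λ c → agree (suc c)))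
  where
  coordinate : ∀ d → (d ≡ false → x ≡ y) → d ∨ does (x ≟ y) ≡ true
  coordinate true  _    = refl
  coordinate false x≡y = dec-true (x ≟ y) (x≡y refl)

inFlat-line : ∀ {n k} (i : Fin k) (X Y : Vec (Fin n) k) →
              (∀ c → c ≢ i → lookup X c ≡ lookup Y c) → inFlat ⁅ i ⁆ X Y ≡ true
inFlat-line i X Y agree = inFlat-intro ⁅ i ⁆ X Y (λ c c∉⁅i⁆ → agree c (λ { refl → true≢false c∉⁅i⁆ }))
  where
  true≢false : ¬ lookup ⁅ i ⁆ i ≡ false
  true≢false i∉⁅i⁆ with trans (sym ([]=⇒lookup (x∈⁅x⁆ i))) i∉⁅i⁆
  ... | ()

∣⁅i⁆∩⁅j⁆∣≡0 : ∀ {k} {i j : Fin k} → i ≢ j → ∣ ⁅ i ⁆ ∩ ⁅ j ⁆ ∣ ≡ 0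
∣⁅i⁆∩⁅j⁆∣≡0 {i = zero}  {zero}  i≢j = contradiction refl i≢j
∣⁅i⁆∩⁅j⁆∣≡0 {suc k} {zero}  {suc j} _ = trans (cong ∣_∣ (∩-zeroˡ ⁅ j ⁆)) (∣⊥∣≡0 k)
∣⁅i⁆∩⁅j⁆∣≡0 {suc k} {suc i} {zero}  _ = trans (cong ∣_∣ (∩-zeroʳ ⁅ i ⁆)) (∣⊥∣≡0 k)
∣⁅i⁆∩⁅j⁆∣≡0 {i = suc i} {suc j} i≢j = ∣⁅i⁆∩⁅j⁆∣≡0 (i≢j ∘ cong suc)

∣⁅i⁆∪⁅j⁆∣≡2 : ∀ {k} {i j : Fin k} → i ≢ j → ∣ ⁅ i ⁆ ∪ ⁅ j ⁆ ∣ ≡ 2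
∣⁅i⁆∪⁅j⁆∣≡2 {i = zero}  {zero}  i≢j = contradiction refl i≢j
∣⁅i⁆∪⁅j⁆∣≡2 {i = zero}  {suc j} _ = cong suc (trans (cong ∣_∣ (∪-identityˡ ⁅ j ⁆)) (∣⁅x⁆∣≡1 j))
∣⁅i⁆∪⁅j⁆∣≡2 {i = suc i} {zero}  _ = cong suc (trans (cong ∣_∣ (∪-identityʳ ⁅ i ⁆)) (∣⁅x⁆∣≡1 i))
∣⁅i⁆∪⁅j⁆∣≡2 {i = suc i} {suc j} i≢j = ∣⁅i⁆∪⁅j⁆∣≡2 (i≢j ∘ cong suc)

n^∣⁅i⁆∣≡n : ∀ n {k} (i : Fin k) → n ^ ∣ ⁅ i ⁆ ∣ ≡ n
n^∣⁅i⁆∣≡n n i = trans (cong (n ^_) (∣⁅x⁆∣≡1 i)) (*-identityʳ n)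

line-size : ∀ {n k} (i : Fin k) (X : Vec (Fin n) k) → ∑ᴴ (λ Y → 𝟙 (inFlat ⁅ i ⁆ X Y)) ≡ n
line-size {n} i X = trans (flat-size ⁅ i ⁆ X) (n^∣⁅i⁆∣≡n n i)

𝟙-*-cong : ∀ b {x y} → (b ≡ true → x ≡ y) → 𝟙 b * x ≡ 𝟙 b * y
𝟙-*-cong true  x≡y = cong (_+ 0) (x≡y refl)
𝟙-*-cong false _   = refl

incidences : ∀ {n k m} → Subset k → (Fin m → Vec (Fin n) k) → (Fin m → ℕ) → Vec (Fin n) k → ℕ
incidences {m = m} M P w X = ∑[ r < m ] (w r * 𝟙 (inFlat M (P r) X))

incidences-coarsen : ∀ {n k m} {M′ M : Subset k} (P : Fin m → Vec (Fin n) k) (w : Fin m → ℕ) →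
  M′ ⊆ M → ∀ {X Y} → inFlat M′ X Y ≡ true → incidences M P w X ≡ incidences M P w Y
incidences-coarsen {m = m} P w M′⊆M XY =
  sum-cong-≗ {m} (λ r → cong (λ b → w r * 𝟙 b) (inFlat-coarsen M′⊆M (P r) XY))

∑ᴴ-flat-incidences : ∀ {n k m} (M : Subset k) (P : Fin m → Vec (Fin n) k) (w : Fin m → ℕ)
  (g : Vec (Fin n) k → ℕ) → (∀ {X Y} → inFlat M X Y ≡ true → g X ≡ g Y) →
  ∑ᴴ (λ X → incidences M P w X * g X) ≡ n ^ ∣ M ∣ * ∑[ r < m ] (w r * g (P r))
∑ᴴ-flat-incidences {n} {k} {m} M P w g g-flat = begin
  ∑ᴴ (λ X → incidences M P w X * g X)
    ≡⟨ ∑ᴴ-cong (λ X → trans (*-distribʳ-sum {m} (g X) _) (sum-cong-≗ {m} (λ r → move-g r X))) ⟩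
  ∑ᴴ (λ X → ∑[ r < m ] (w r * g (P r) * 𝟙 (inFlat M (P r) X)))
    ≡⟨ ∑ᴴ-∑-comm (λ X r → w r * g (P r) * 𝟙 (inFlat M (P r) X)) ⟩
  ∑[ r < m ] ∑ᴴ (λ X → w r * g (P r) * 𝟙 (inFlat M (P r) X))
    ≡⟨ sum-cong-≗ {m} (λ r → sym (*-distribˡ-∑ᴴ (w r * g (P r)) (λ X → 𝟙 (inFlat M (P r) X)))) ⟩
  ∑[ r < m ] (w r * g (P r) * ∑ᴴ (λ X → 𝟙 (inFlat M (P r) X)))
    ≡⟨ sum-cong-≗ {m} (λ r → cong (w r * g (P r) *_) (flat-size M (P r))) ⟩
  ∑[ r < m ] (w r * g (P r) * n ^ ∣ M ∣)
    ≡⟨ *-distribʳ-sum {m} (n ^ ∣ M ∣) _ ⟨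
  ∑[ r < m ] (w r * g (P r)) * n ^ ∣ M ∣
    ≡⟨ *-comm _ (n ^ ∣ M ∣) ⟩
  n ^ ∣ M ∣ * ∑[ r < m ] (w r * g (P r))
    ∎
  where
  open ≡-Reasoning
  move-g : ∀ r X → w r * 𝟙 (inFlat M (P r) X) * g X ≡ w r * g (P r) * 𝟙 (inFlat M (P r) X)
  move-g r X = begin
    w r * 𝟙 b * g X       ≡⟨ *-assoc (w r) (𝟙 b) (g X) ⟩
    w r * (𝟙 b * g X)     ≡⟨ cong (w r *_) (𝟙-*-cong b (λ on → sym (g-flat on))) ⟩
    w r * (𝟙 b * g (P r)) ≡⟨ *-assoc (w r) (𝟙 b) (g (P r)) ⟨
    w r * 𝟙 b * g (P r)   ≡⟨ xy∙z≈xz∙y (w r) (𝟙 b) (g (P r)) ⟩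
    w r * g (P r) * 𝟙 b   ∎
    where
    b : Bool
    b = inFlat M (P r) X

-- An i-line and a j-line meet, in exactly one point, iff they lie in a common i–j plane.
∑ᴴ-line-incidences : ∀ {n k m} {i j : Fin k} → i ≢ j →
  (P : Fin m → Vec (Fin n) k) (w : Fin m → ℕ) (X : Vec (Fin n) k) →
  ∑ᴴ (λ Y → 𝟙 (inFlat ⁅ i ⁆ X Y) * incidences ⁅ j ⁆ P w Y) ≡ incidences (⁅ i ⁆ ∪ ⁅ j ⁆) P w X
∑ᴴ-line-incidences {n} {k} {m} {i} {j} i≢j P w X = begin
  ∑ᴴ (λ Y → 𝟙 (onLine Y) * ∑[ r < m ] (w r * 𝟙 (inFlat ⁅ j ⁆ (P r) Y)))
    ≡⟨ ∑ᴴ-cong (λ Y → trans (*-distribˡ-sum {m} (𝟙 (onLine Y)) _) (sum-cong-≗ {m} (λ r → pull-w r Y))) ⟩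
  ∑ᴴ (λ Y → ∑[ r < m ] (w r * meet r Y))
    ≡⟨ ∑ᴴ-∑-comm (λ Y r → w r * meet r Y) ⟩
  ∑[ r < m ] ∑ᴴ (λ Y → w r * meet r Y)
    ≡⟨ sum-cong-≗ {m} (λ r → sym (*-distribˡ-∑ᴴ (w r) (meet r))) ⟩
  ∑[ r < m ] (w r * ∑ᴴ (meet r))
    ≡⟨ sum-cong-≗ {m} (λ r → cong (w r *_) (flat-intersection-size ⁅ i ⁆ ⁅ j ⁆ X (P r))) ⟩
  ∑[ r < m ] (w r * (𝟙 (inFlat plane X (P r)) * n ^ ∣ ⁅ i ⁆ ∩ ⁅ j ⁆ ∣))
    ≡⟨ sum-cong-≗ {m} (λ r → cong (w r *_) (planar r)) ⟩
  ∑[ r < m ] (w r * 𝟙 (inFlat plane (P r) X))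
    ∎
  where
  open ≡-Reasoning
  plane : Subset k
  plane = ⁅ i ⁆ ∪ ⁅ j ⁆
  onLine : Vec (Fin n) k → Bool
  onLine = inFlat ⁅ i ⁆ X
  meet : Fin m → Vec (Fin n) k → ℕ
  meet r Y = 𝟙 (onLine Y) * 𝟙 (inFlat ⁅ j ⁆ (P r) Y)
  pull-w : ∀ r Y → 𝟙 (onLine Y) * (w r * 𝟙 (inFlat ⁅ j ⁆ (P r) Y)) ≡ w r * meet r Y
  pull-w r Y = x∙yz≈y∙xz (𝟙 (onLine Y)) (w r) _
  planar : ∀ r → 𝟙 (inFlat plane X (P r)) * n ^ ∣ ⁅ i ⁆ ∩ ⁅ j ⁆ ∣ ≡ 𝟙 (inFlat plane (P r) X)
  planar r = begin
    𝟙 (inFlat plane X (P r)) * n ^ ∣ ⁅ i ⁆ ∩ ⁅ j ⁆ ∣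
      ≡⟨ cong (λ e → 𝟙 (inFlat plane X (P r)) * n ^ e) (∣⁅i⁆∩⁅j⁆∣≡0 i≢j) ⟩
    𝟙 (inFlat plane X (P r)) * 1
      ≡⟨ *-identityʳ _ ⟩
    𝟙 (inFlat plane X (P r))
      ≡⟨ cong 𝟙 (inFlat-sym plane X (P r)) ⟩
    𝟙 (inFlat plane (P r) X) ∎

∑ᴴ-along-lines : ∀ {n k} (i : Fin k) (f : Vec (Fin n) k → ℕ) →
  ∑ᴴ (λ X → ∑ᴴ (λ Y → 𝟙 (inFlat ⁅ i ⁆ X Y) * f Y)) ≡ n * ∑ᴴ f
∑ᴴ-along-lines {n} i f = begin
  ∑ᴴ (λ X → ∑ᴴ (λ Y → 𝟙 (inFlat ⁅ i ⁆ X Y) * f Y))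
    ≡⟨ ∑ᴴ-comm (λ X Y → 𝟙 (inFlat ⁅ i ⁆ X Y) * f Y) ⟩
  ∑ᴴ (λ Y → ∑ᴴ (λ X → 𝟙 (inFlat ⁅ i ⁆ X Y) * f Y))
    ≡⟨ ∑ᴴ-cong (λ Y → sym (*-distribʳ-∑ᴴ (f Y) (λ X → 𝟙 (inFlat ⁅ i ⁆ X Y)))) ⟩
  ∑ᴴ (λ Y → ∑ᴴ (λ X → 𝟙 (inFlat ⁅ i ⁆ X Y)) * f Y)
    ≡⟨ ∑ᴴ-cong (λ Y → cong (_* f Y) line-through-Y) ⟩
  ∑ᴴ (λ Y → n * f Y)
    ≡⟨ *-distribˡ-∑ᴴ n f ⟨
  n * ∑ᴴ f ∎
  where
  open ≡-Reasoning
  line-through-Y : ∀ {Y} → ∑ᴴ (λ X → 𝟙 (inFlat ⁅ i ⁆ X Y)) ≡ n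
  line-through-Y {Y} = trans (∑ᴴ-cong (λ X → cong 𝟙 (inFlat-sym ⁅ i ⁆ X Y))) (line-size i Y)

-- Sums over ordered pairs of distinct coordinates

∑≢ : ∀ {k} → (Fin k → Fin k → ℕ) → ℕ
∑≢ {k} f = ∑[ i < k ] ∑[ j < k ] (𝟙 (not (does (i ≟ j))) * f i j)

∑≢-mono : ∀ {k} {f g : Fin k → Fin k → ℕ} → (∀ {i j} → i ≢ j → f i j ≤ g i j) → ∑≢ f ≤ ∑≢ g
∑≢-mono {k} {f} {g} f≤g = ∑-mono {k} (λ i → ∑-mono {k} (λ j → off-diagonal i j))
  where
  off-diagonal : ∀ i j → 𝟙 (not (does (i ≟ j))) * f i j ≤ 𝟙 (not (does (i ≟ j))) * g i j
  off-diagonal i j with i ≟ j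
  ... | yes _   = z≤n
  ... | no  i≢j = *-monoʳ-≤ 1 (f≤g i≢j)

∑≢-const≤ : ∀ k c → ∑≢ {k} (λ _ _ → c) ≤ k * (k * c)
∑≢-const≤ k c = begin
  ∑[ i < k ] ∑[ j < k ] (𝟙 (not (does (i ≟ j))) * c)
    ≤⟨ ∑-mono {k} (λ i → ∑-mono {k} (λ j → *-monoˡ-≤ c (𝟙≤1 (not (does (i ≟ j)))))) ⟩
  ∑[ i < k ] ∑[ j < k ] (1 * c)
    ≡⟨ sum-cong-≗ {k} (λ _ → ∑-const k (1 * c)) ⟩
  ∑[ i < k ] (k * (1 * c))
    ≡⟨ ∑-const k _ ⟩
  k * (k * (1 * c))
    ≡⟨ cong (λ x → k * (k * x)) (*-identityˡ c) ⟩
  k * (k * c) ∎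
  where open ≤-Reasoning

*-distribˡ-∑≢ : ∀ {k} c (f : Fin k → Fin k → ℕ) → c * ∑≢ f ≡ ∑≢ (λ i j → c * f i j)
*-distribˡ-∑≢ {k} c f = trans (*-distribˡ-sum {k} c _) (sum-cong-≗ {k} row)
  where
  row : ∀ i → c * ∑[ j < k ] (𝟙 (not (does (i ≟ j))) * f i j)
            ≡ ∑[ j < k ] (𝟙 (not (does (i ≟ j))) * (c * f i j))
  row i = trans (*-distribˡ-sum {k} c _)
                (sum-cong-≗ {k} (λ j → x∙yz≈y∙xz c (𝟙 (not (does (i ≟ j)))) (f i j)))

∑≢-∑-comm : ∀ {k m} (f : Fin m → Fin k → Fin k → ℕ) →
            ∑≢ (λ i j → ∑[ r < m ] f r i j) ≡ ∑[ r < m ] ∑≢ (f r)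
∑≢-∑-comm {k} {m} f = begin
  ∑[ i < k ] ∑[ j < k ] (δ i j * ∑[ r < m ] f r i j)
    ≡⟨ sum-cong-≗ {k} (λ i → sum-cong-≗ {k} (λ j → *-distribˡ-sum {m} (δ i j) _)) ⟩
  ∑[ i < k ] ∑[ j < k ] ∑[ r < m ] (δ i j * f r i j)
    ≡⟨ sum-cong-≗ {k} (λ i → ∑-comm {k} {m} _) ⟩
  ∑[ i < k ] ∑[ r < m ] ∑[ j < k ] (δ i j * f r i j)
    ≡⟨ ∑-comm {k} {m} _ ⟩
  ∑[ r < m ] ∑[ i < k ] ∑[ j < k ] (δ i j * f r i j) ∎
  where
  open ≡-Reasoning
  δ : Fin k → Fin k → ℕ
  δ i j = 𝟙 (not (does (i ≟ j)))

∑≢+diagonal : ∀ {k} (f : Fin k → Fin k → ℕ) → ∑≢ f + ∑[ i < k ] f i i ≡ ∑[ i < k ] ∑[ j < k ] f i j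
∑≢+diagonal {k} f =
  trans (sym (∑-distrib-+ {k} _ _)) (sum-cong-≗ {k} (λ i → off-diagonal+diagonal i))
  where
  off-diagonal+diagonal : ∀ i →
    ∑[ j < k ] (𝟙 (not (does (i ≟ j))) * f i j) + f i i ≡ ∑[ j < k ] f i j
  off-diagonal+diagonal i = begin
    ∑[ j < k ] (𝟙 (not (does (i ≟ j))) * f i j) + f i i
      ≡⟨ cong (∑[ j < k ] (𝟙 (not (does (i ≟ j))) * f i j) +_) (∑-𝟙≟ i (f i)) ⟨
    ∑[ j < k ] (𝟙 (not (does (i ≟ j))) * f i j) + ∑[ j < k ] (𝟙 (does (i ≟ j)) * f i j)
      ≡⟨ ∑-distrib-+ {k} _ _ ⟨
    ∑[ j < k ] (𝟙 (not (does (i ≟ j))) * f i j + 𝟙 (does (i ≟ j)) * f i j)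
      ≡⟨ sum-cong-≗ {k} (λ j → split (does (i ≟ j)) (f i j)) ⟩
    ∑[ j < k ] f i j
      ∎
    where
    open ≡-Reasoning
    split : ∀ b x → 𝟙 (not b) * x + 𝟙 b * x ≡ x
    split true  x = +-identityʳ x
    split false x = trans (+-identityʳ (x + 0)) (+-identityʳ x)

∑≢-pairs+∣p∣ : ∀ {k} (p : Subset k) → ∑≢ (λ i j → 𝟙 (lookup p i ∧ lookup p j)) + ∣ p ∣ ≡ ∣ p ∣ * ∣ p ∣
∑≢-pairs+∣p∣ {k} p = begin
  ∑≢ pairs + ∣ p ∣
    ≡⟨ cong (∑≢ pairs +_) diagonal ⟩
  ∑≢ pairs + ∑[ i < k ] pairs i i
    ≡⟨ ∑≢+diagonal pairs ⟩
  ∑[ i < k ] ∑[ j < k ] pairs i j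
    ≡⟨ sum-cong-≗ {k} (λ i → sum-cong-≗ {k} (λ j → 𝟙-∧ (lookup p i) (lookup p j))) ⟩
  ∑[ i < k ] ∑[ j < k ] (𝟙 (lookup p i) * 𝟙 (lookup p j))
    ≡⟨ sum-cong-≗ {k} (λ i → *-distribˡ-sum {k} (𝟙 (lookup p i)) _) ⟨
  ∑[ i < k ] (𝟙 (lookup p i) * ∑[ j < k ] 𝟙 (lookup p j))
    ≡⟨ *-distribʳ-sum {k} _ _ ⟨
  ∑[ i < k ] 𝟙 (lookup p i) * ∑[ j < k ] 𝟙 (lookup p j)
    ≡⟨ cong₂ _*_ (∣p∣≡∑𝟙 p) (∣p∣≡∑𝟙 p) ⟨
  ∣ p ∣ * ∣ p ∣ ∎
  where
  open ≡-Reasoning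
  pairs : Fin k → Fin k → ℕ
  pairs i j = 𝟙 (lookup p i ∧ lookup p j)
  diagonal : ∣ p ∣ ≡ ∑[ i < k ] pairs i i
  diagonal = trans (∣p∣≡∑𝟙 p) (sum-cong-≗ {k} (λ i → cong 𝟙 (sym (∧-idem (lookup p i)))))

-- The lines of a rook configuration

module Incidence {n k m : ℕ} (P : Fin m → Vec (Fin n) k) (D : Fin m → Subset k) where

  hits : Fin k → Vec (Fin n) k → ℕ
  hits i = incidences ⁅ i ⁆ P (λ r → 𝟙 (lookup (D r) i))

  -- A rook standing on Y is counted once for each of its directions.
  coverage : Vec (Fin n) k → ℕ
  coverage Y = ∑[ i < k ] hits i Y

  ∑ᴴ-hits : ∀ i → ∑ᴴ (hits i) ≡ n * ∑[ r < m ] 𝟙 (lookup (D r) i)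
  ∑ᴴ-hits i = begin
    ∑ᴴ (hits i)
      ≡⟨ ∑ᴴ-cong (λ X → sym (*-identityʳ (hits i X))) ⟩
    ∑ᴴ (λ X → hits i X * 1)
      ≡⟨ ∑ᴴ-flat-incidences ⁅ i ⁆ P (λ r → 𝟙 (lookup (D r) i)) (λ _ → 1) (λ _ → refl) ⟩
    n ^ ∣ ⁅ i ⁆ ∣ * ∑[ r < m ] (𝟙 (lookup (D r) i) * 1)
      ≡⟨ cong₂ _*_ (n^∣⁅i⁆∣≡n n i) (sum-cong-≗ {m} (λ r → *-identityʳ _)) ⟩
    n * ∑[ r < m ] 𝟙 (lookup (D r) i) ∎
    where open ≡-Reasoning

  ∑ᴴ-coverage : ∑ᴴ coverage ≡ n * ∑[ r < m ] ∣ D r ∣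
  ∑ᴴ-coverage = begin
    ∑ᴴ (λ Y → ∑[ i < k ] hits i Y)
      ≡⟨ ∑ᴴ-∑-comm (λ Y i → hits i Y) ⟩
    ∑[ i < k ] ∑ᴴ (hits i)
      ≡⟨ sum-cong-≗ {k} ∑ᴴ-hits ⟩
    ∑[ i < k ] (n * ∑[ r < m ] 𝟙 (lookup (D r) i))
      ≡⟨ *-distribˡ-sum {k} n _ ⟨
    n * ∑[ i < k ] ∑[ r < m ] 𝟙 (lookup (D r) i)
      ≡⟨ cong (n *_) (∑-comm {k} {m} _) ⟩
    n * ∑[ r < m ] ∑[ i < k ] 𝟙 (lookup (D r) i)
      ≡⟨ cong (n *_) (sum-cong-≗ {m} (λ r → sym (∣p∣≡∑𝟙 (D r)))) ⟩
    n * ∑[ r < m ] ∣ D r ∣ ∎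
    where open ≡-Reasoning

  rookLines : Fin m → Vec (Fin n) k → ℕ
  rookLines r Y = ∑[ i < k ] (𝟙 (lookup (D r) i) * 𝟙 (inFlat ⁅ i ⁆ (P r) Y))

  rookLines≤coverage : ∀ r Y → rookLines r Y ≤ coverage Y
  rookLines≤coverage r Y =
    subst (rookLines r Y ≤_) (sym (∑-comm {k} {m} (λ i r → 𝟙 (lookup (D r) i) * 𝟙 (inFlat ⁅ i ⁆ (P r) Y))))
      (term≤∑ (λ r → rookLines r Y) r)

  coverage-identity : ∀ {ℓ} → (∀ r → ∣ D r ∣ ≡ ℓ) → (∀ Y → 1 ≤ coverage Y) →
                      n * (m * ℓ) ≡ n ^ k + ∑ᴴ (λ Y → coverage Y ∸ 1)
  coverage-identity {ℓ} ∣D∣≡ℓ covered = begin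
    n * (m * ℓ)
      ≡⟨ cong (n *_) (trans (sum-cong-≗ {m} ∣D∣≡ℓ) (∑-const m ℓ)) ⟨
    n * ∑[ r < m ] ∣ D r ∣
      ≡⟨ ∑ᴴ-coverage ⟨
    ∑ᴴ coverage
      ≡⟨ ∑ᴴ-cong (λ Y → sym (m+[n∸m]≡n (covered Y))) ⟩
    ∑ᴴ (λ Y → 1 + (coverage Y ∸ 1))
      ≡⟨ ∑ᴴ-distrib-+ (λ _ → 1) (λ Y → coverage Y ∸ 1) ⟩
    ∑ᴴ {n} {k} (λ _ → 1) + ∑ᴴ (λ Y → coverage Y ∸ 1)
      ≡⟨ cong (_+ ∑ᴴ (λ Y → coverage Y ∸ 1)) (trans (∑ᴴ-const n k 1) (*-identityʳ (n ^ k))) ⟩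
    n ^ k + ∑ᴴ (λ Y → coverage Y ∸ 1) ∎
    where open ≡-Reasoning

  pairExcess : Fin k → Fin k → Vec (Fin n) k → ℕ
  pairExcess i j Y = hits i Y + hits j Y ∸ 1

  pairExcess≤ : ∀ {i j} → i ≢ j → ∀ Y → pairExcess i j Y ≤ coverage Y ∸ 1
  pairExcess≤ i≢j Y = ∸-monoˡ-≤ 1 (distinct-terms≤∑ (λ l → hits l Y) i≢j)

  isCross : Fin k → Fin k → Fin m → Bool
  isCross i j r = lookup (D r) i ∧ lookup (D r) j

  crossCount : Fin k → Fin k → ℕ
  crossCount i j = ∑[ r < m ] 𝟙 (isCross i j r)

  module Pair {i j : Fin k} (i≢j : i ≢ j) {t : ℕ} (t≤n : t ≤ n) where

    plane : Subset k
    plane = ⁅ i ⁆ ∪ ⁅ j ⁆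

    crosses : Vec (Fin n) k → ℕ
    crosses = incidences plane P (𝟙 ∘ isCross i j)

    jRooks : Vec (Fin n) k → ℕ
    jRooks = incidences plane P (λ r → 𝟙 (lookup (D r) j))

    crosses≤jRooks : ∀ X → crosses X ≤ jRooks X
    crosses≤jRooks X = ∑-mono {m} (λ r → *-monoˡ-≤ _ (𝟙-∧≤ʳ (lookup (D r) i) (lookup (D r) j)))

    ∑ᴴ-line-excess : ∀ X {a} → hits i X ≡ suc a →
      ∑ᴴ (λ Y → 𝟙 (inFlat ⁅ i ⁆ X Y) * pairExcess i j Y) ≡ n * a + jRooks X
    ∑ᴴ-line-excess X {a} hits≡1+a = begin
      ∑ᴴ (λ Y → 𝟙 (onLine Y) * pairExcess i j Y)
        ≡⟨ ∑ᴴ-cong (λ Y → 𝟙-*-cong (onLine Y) (cong (λ h → h + hits j Y ∸ 1) ∘ hits-on-line)) ⟩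
      ∑ᴴ (λ Y → 𝟙 (onLine Y) * (a + hits j Y))
        ≡⟨ ∑ᴴ-cong (λ Y → *-distribˡ-+ (𝟙 (onLine Y)) a (hits j Y)) ⟩
      ∑ᴴ (λ Y → 𝟙 (onLine Y) * a + 𝟙 (onLine Y) * hits j Y)
        ≡⟨ ∑ᴴ-distrib-+ (λ Y → 𝟙 (onLine Y) * a) (λ Y → 𝟙 (onLine Y) * hits j Y) ⟩
      ∑ᴴ (λ Y → 𝟙 (onLine Y) * a) + ∑ᴴ (λ Y → 𝟙 (onLine Y) * hits j Y)
        ≡⟨ cong₂ _+_ (trans (sym (*-distribʳ-∑ᴴ a (𝟙 ∘ onLine))) (cong (_* a) (line-size i X)))
                     (∑ᴴ-line-incidences i≢j P (λ r → 𝟙 (lookup (D r) j)) X) ⟩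
      n * a + jRooks X
        ∎
      where
      open ≡-Reasoning
      onLine : Vec (Fin n) k → Bool
      onLine = inFlat ⁅ i ⁆ X
      hits-on-line : ∀ {Y} → onLine Y ≡ true → hits i Y ≡ suc a
      hits-on-line on =
        trans (sym (incidences-coarsen {M′ = ⁅ i ⁆} P (λ r → 𝟙 (lookup (D r) i)) ⊆-refl on)) hits≡1+a

    line-excess-bound : ∀ X →
      hits i X * (n ⊓ jRooks X) ≤ ∑ᴴ (λ Y → 𝟙 (inFlat ⁅ i ⁆ X Y) * pairExcess i j Y)
    line-excess-bound X with hits i X in hits≡
    ... | zero  = z≤n
    ... | suc a = begin
      suc a * (n ⊓ jRooks X)
        ≤⟨ +-mono-≤ (m⊓n≤n n (jRooks X)) (*-monoʳ-≤ a (m⊓n≤m n (jRooks X))) ⟩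
      jRooks X + a * n
        ≡⟨ +-comm (jRooks X) (a * n) ⟩
      a * n + jRooks X
        ≡⟨ cong (_+ jRooks X) (*-comm a n) ⟩
      n * a + jRooks X
        ≡⟨ ∑ᴴ-line-excess X hits≡ ⟨
      ∑ᴴ (λ Y → 𝟙 (inFlat ⁅ i ⁆ X Y) * pairExcess i j Y) ∎
      where open ≤-Reasoning

    capped : ℕ
    capped = ∑[ r < m ] (𝟙 (lookup (D r) i) * (n ⊓ jRooks (P r)))

    capped-bound : n * capped ≤ n * ∑ᴴ (pairExcess i j)
    capped-bound = begin
      n * capped
        ≡⟨ cong (_* capped) (n^∣⁅i⁆∣≡n n i) ⟨
      n ^ ∣ ⁅ i ⁆ ∣ * capped
        ≡⟨ ∑ᴴ-flat-incidences ⁅ i ⁆ P (λ r → 𝟙 (lookup (D r) i)) (λ X → n ⊓ jRooks X)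
             (λ on → cong (n ⊓_) (incidences-coarsen {M′ = ⁅ i ⁆} P (λ r → 𝟙 (lookup (D r) j))
                                                                (p⊆p∪q ⁅ j ⁆) on)) ⟨
      ∑ᴴ (λ X → hits i X * (n ⊓ jRooks X))
        ≤⟨ ∑ᴴ-mono line-excess-bound ⟩
      ∑ᴴ (λ X → ∑ᴴ (λ Y → 𝟙 (inFlat ⁅ i ⁆ X Y) * pairExcess i j Y))
        ≡⟨ ∑ᴴ-along-lines i (pairExcess i j) ⟩
      n * ∑ᴴ (pairExcess i j)
        ∎
      where open ≤-Reasoning

    isSparse : Vec (Fin n) k → Bool
    isSparse X = crosses X <ᵇ t

    sparse : ℕ
    sparse = ∑[ r < m ] (𝟙 (isCross i j r) * 𝟙 (isSparse (P r)))

    sparse-bound : n * n * sparse ≤ n ^ k * t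
    sparse-bound = begin
      n * n * sparse
        ≡⟨ cong (_* sparse) (n^∣⁅i⁆∪⁅j⁆∣≡n*n) ⟨
      n ^ ∣ plane ∣ * sparse
        ≡⟨ ∑ᴴ-flat-incidences plane P (𝟙 ∘ isCross i j) (𝟙 ∘ isSparse)
             (λ on → cong (λ c → 𝟙 (c <ᵇ t))
                          (incidences-coarsen {M′ = plane} P (𝟙 ∘ isCross i j) ⊆-refl on)) ⟨
      ∑ᴴ (λ X → crosses X * 𝟙 (isSparse X))
        ≤⟨ ∑ᴴ-mono (λ X → below-threshold (crosses X)) ⟩
      ∑ᴴ {n} {k} (λ _ → t)
        ≡⟨ ∑ᴴ-const n k t ⟩
      n ^ k * t
        ∎
      where
      open ≤-Reasoning
      n^∣⁅i⁆∪⁅j⁆∣≡n*n : n ^ ∣ plane ∣ ≡ n * n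
      n^∣⁅i⁆∪⁅j⁆∣≡n*n = trans (cong (n ^_) (∣⁅i⁆∪⁅j⁆∣≡2 i≢j)) (cong (n *_) (*-identityʳ n))
      below-threshold : ∀ x → x * 𝟙 (x <ᵇ t) ≤ t
      below-threshold x with x <ᵇ t | <ᵇ-reflects-< x t
      ... | true  | ofʸ x<t = ≤-trans (≤-reflexive (*-identityʳ x)) (<⇒≤ x<t)
      ... | false | ofⁿ _   = subst (_≤ t) (sym (*-zeroʳ x)) z≤n

    crossCount-split : t * crossCount i j ≤ capped + t * sparse
    crossCount-split = begin
      t * crossCount i j
        ≡⟨ *-distribˡ-sum {m} t _ ⟩
      ∑[ r < m ] (t * 𝟙 (isCross i j r))
        ≤⟨ ∑-mono {m} (λ r → per-rook (lookup (D r) i) (lookup (D r) j) (crosses≤jRooks (P r))) ⟩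
      ∑[ r < m ] (𝟙 (lookup (D r) i) * (n ⊓ jRooks (P r)) + t * (𝟙 (isCross i j r) * 𝟙 (isSparse (P r))))
        ≡⟨ ∑-distrib-+ {m} _ _ ⟩
      capped + ∑[ r < m ] (t * (𝟙 (isCross i j r) * 𝟙 (isSparse (P r))))
        ≡⟨ cong (capped +_) (*-distribˡ-sum {m} t _) ⟨
      capped + t * sparse
        ∎
      where
      open ≤-Reasoning
      -- A cross in a plane with at least t crosses has at least t rooks using j there.
      per-rook : ∀ a b {x y} → x ≤ y → t * 𝟙 (a ∧ b) ≤ 𝟙 a * (n ⊓ y) + t * (𝟙 (a ∧ b) * 𝟙 (x <ᵇ t))
      per-rook false b     _   = ≤-trans (≤-reflexive (*-zeroʳ t)) z≤n
      per-rook true  false _   = ≤-trans (≤-reflexive (*-zeroʳ t)) z≤n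
      per-rook true  true  {x} {y} x≤y with x <ᵇ t | <ᵇ-reflects-< x t
      ... | true  | ofʸ _   = m≤n+m _ _
      ... | false | ofⁿ x≮t = begin
        t * 1               ≡⟨ *-identityʳ t ⟩
        t                   ≤⟨ ⊓-glb t≤n (≤-trans (≮⇒≥ x≮t) x≤y) ⟩
        n ⊓ y               ≡⟨ *-identityˡ (n ⊓ y) ⟨
        1 * (n ⊓ y)         ≤⟨ m≤m+n _ _ ⟩
        1 * (n ⊓ y) + t * 0 ∎

    pair-bound : t * (n * n) * crossCount i j ≤ n * (n * ∑ᴴ (pairExcess i j)) + t * (n ^ k * t)
    pair-bound = begin
      t * (n * n) * crossCount i j            ≡⟨ xy∙z≈y∙xz t (n * n) (crossCount i j) ⟩
      n * n * (t * crossCount i j)            ≤⟨ *-monoʳ-≤ (n * n) crossCount-split ⟩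
      n * n * (capped + t * sparse)        ≡⟨ distribute n n capped t sparse ⟩
      n * (n * capped) + t * (n * n * sparse)
        ≤⟨ +-mono-≤ (*-monoʳ-≤ n capped-bound) (*-monoʳ-≤ t sparse-bound) ⟩
      n * (n * ∑ᴴ (pairExcess i j)) + t * (n ^ k * t) ∎
      where
      open ≤-Reasoning
      distribute : ∀ a b c d e → a * b * (c + d * e) ≡ a * (b * c) + d * (a * b * e)
      distribute = solve-∀

  crossPairs-bound : ∀ {t} → t ≤ n →
    t * (n * n) * ∑≢ crossCount ≤ k * (k * (n * (n * ∑ᴴ (λ Y → coverage Y ∸ 1)) + t * (n ^ k * t)))
  crossPairs-bound {t} t≤n = begin
    t * (n * n) * ∑≢ crossCount                   ≡⟨ *-distribˡ-∑≢ (t * (n * n)) crossCount ⟩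
    ∑≢ (λ i j → t * (n * n) * crossCount i j)     ≤⟨ ∑≢-mono {k} per-pair ⟩
    ∑≢ {k} (λ _ _ → n * (n * overcount) + t * (n ^ k * t))
                                                 ≤⟨ ∑≢-const≤ k _ ⟩
    k * (k * (n * (n * overcount) + t * (n ^ k * t))) ∎
    where
    open ≤-Reasoning
    overcount : ℕ
    overcount = ∑ᴴ (λ Y → coverage Y ∸ 1)
    per-pair : ∀ {i j} → i ≢ j → t * (n * n) * crossCount i j ≤ n * (n * overcount) + t * (n ^ k * t)
    per-pair i≢j = ≤-trans (Pair.pair-bound i≢j t≤n)
                           (+-monoˡ-≤ _ (*-monoʳ-≤ n (*-monoʳ-≤ n (∑ᴴ-mono (pairExcess≤ i≢j)))))

  crossPairs-identity : ∀ {ℓ} → (∀ r → ∣ D r ∣ ≡ ℓ) → ∑≢ crossCount + m * ℓ ≡ m * (ℓ * ℓ)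
  crossPairs-identity {ℓ} ∣D∣≡ℓ = begin
    ∑≢ crossCount + m * ℓ
      ≡⟨ cong₂ _+_ (sym (∑≢-∑-comm (λ r i j → 𝟙 (isCross i j r)))) (∑-const m ℓ) ⟨
    ∑[ r < m ] ∑≢ (λ i j → 𝟙 (isCross i j r)) + ∑[ r < m ] ℓ
      ≡⟨ ∑-distrib-+ {m} _ _ ⟨
    ∑[ r < m ] (∑≢ (λ i j → 𝟙 (isCross i j r)) + ℓ)
      ≡⟨ sum-cong-≗ {m} (λ r → subst (λ s → ∑≢ (λ i j → 𝟙 (isCross i j r)) + s ≡ s * s) (∣D∣≡ℓ r)
                                      (∑≢-pairs+∣p∣ (D r))) ⟩
    ∑[ r < m ] (ℓ * ℓ)
      ≡⟨ ∑-const m (ℓ * ℓ) ⟩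
    m * (ℓ * ℓ)
      ∎
    where open ≡-Reasoning

gap-inequality : ∀ k t {N W a Q} .{{_ : NonZero k}} .{{_ : NonZero t}} →
  let T = 2 * (k * k) ; n = T * t in
  n * a ≡ N + W → a ≤ Q → t * (n * n) * Q ≤ k * (k * (n * (n * W) + t * (N * t))) →
  (T * T + 1) * N ≤ T * T * (n * a)
gap-inequality k t {N} {W} {a} {Q} n*a≡N+W a≤Q bound = begin
  (T * T + 1) * N       ≡⟨ trans (*-distribʳ-+ N (T * T) 1) (cong (T * T * N +_) (*-identityˡ N)) ⟩
  T * T * N + N         ≤⟨ +-monoʳ-≤ (T * T * N) N≤T²W ⟩
  T * T * N + T * T * W ≡⟨ *-distribˡ-+ (T * T) N W ⟨
  T * T * (N + W)       ≡⟨ cong (T * T *_) n*a≡N+W ⟨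
  T * T * (n * a)       ∎
  where
  open ≤-Reasoning
  K T n c : ℕ
  K = k * k
  T = 2 * K
  n = T * t
  c = K * (t * t)
  instance
    c≢0 : NonZero c
    c≢0 = m*n≢0 K (t * t) {{m*n≢0 k k}} {{m*n≢0 t t}}
  -- With T = 2k², the t·n·N = 2·c·N on the left outweighs the c·N lost to the k² pairs (i, j).
  t*n*N≡c*N+c*N : t * n * N ≡ c * N + c * N
  t*n*N≡c*N+c*N = by-ring k t N
    where
    by-ring : ∀ k t N → t * (2 * (k * k) * t) * N ≡ k * k * (t * t) * N + k * k * (t * t) * N
    by-ring = solve-∀
  t*n*N+t*n*W≡t*n²*a : t * n * N + t * n * W ≡ t * (n * n) * a
  t*n*N+t*n*W≡t*n²*a = begin-equality
    t * n * N + t * n * W ≡⟨ *-distribˡ-+ (t * n) N W ⟨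
    t * n * (N + W)       ≡⟨ cong (t * n *_) n*a≡N+W ⟨
    t * n * (n * a)       ≡⟨ by-ring t n a ⟩
    t * (n * n) * a       ∎
    where
    by-ring : ∀ t n a → t * n * (n * a) ≡ t * (n * n) * a
    by-ring = solve-∀
  bound≡ : k * (k * (n * (n * W) + t * (N * t))) ≡ c * (T * T * W) + c * N
  bound≡ = by-ring k t N W
    where
    by-ring : ∀ k t N W → k * (k * (2 * (k * k) * t * (2 * (k * k) * t * W) + t * (N * t)))
                        ≡ k * k * (t * t) * (2 * (k * k) * (2 * (k * k)) * W) + k * k * (t * t) * N
    by-ring = solve-∀
  N≤T²W : N ≤ T * T * W
  N≤T²W = *-cancelˡ-≤ c (+-cancelʳ-≤ (c * N) (c * N) (c * (T * T * W)) (begin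
    c * N + c * N                         ≡⟨ t*n*N≡c*N+c*N ⟨
    t * n * N                             ≤⟨ m≤m+n _ _ ⟩
    t * n * N + t * n * W                 ≡⟨ t*n*N+t*n*W≡t*n²*a ⟩
    t * (n * n) * a                       ≤⟨ *-monoʳ-≤ (t * (n * n)) a≤Q ⟩
    t * (n * n) * Q                       ≤⟨ bound ⟩
    k * (k * (n * (n * W) + t * (N * t))) ≡⟨ bound≡ ⟩
    c * (T * T * W) + c * N               ∎))

-- Only here is +_ in scope, where it cannot be confused with sections of ℕ's _+_.
module _ where
  open import Data.Integer using (+_)

  toℚᵘ-/ : ∀ i n .{{_ : NonZero n}} → ℚ.toℚᵘ (i ℚ./ n) ℚᵘ.≃ ℚᵘ.mkℚᵘ i (pred n)
  toℚᵘ-/ i (suc n) = ℚ.toℚᵘ-fromℚᵘ (ℚᵘ.mkℚᵘ i n)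

  0<1/n : ∀ n .{{_ : NonZero n}} → 0ℚ ℚ.< + 1 ℚ./ n
  0<1/n (suc n) =
    ℚ.toℚᵘ-cancel-< (ℚᵘ.<-respʳ-≃ (ℚᵘ.≃-sym (toℚᵘ-/ (+ 1) (suc n))) (ℚᵘ.*<* (ℤ.+<+ (s≤s z≤n))))

  ℚᵘ-gap : ∀ m D′ ℓ′ X′ → suc D′ * suc ℓ′ + suc D′ * suc X′ ≤ m * suc ℓ′ * suc X′ →
           ℚᵘ.mkℚᵘ (+ 1) X′ ℚᵘ.≤ ℚᵘ.mkℚᵘ (+ m) D′ ℚᵘ.- ℚᵘ.mkℚᵘ (+ 1) ℓ′
  ℚᵘ-gap m D′ ℓ′ X′ h = ℚᵘ.*≤* (begin
    + 1 ℤ.* + (D * ℓ)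
      ≡⟨ ℤ.*-identityˡ _ ⟩
    + (D * ℓ)
      ≡⟨ x≡[x+y]-y (+ (D * ℓ)) (+ (D * X)) ⟩
    (+ (D * ℓ) ℤ.+ + (D * X)) ℤ.- + (D * X)
      ≡⟨ cong (ℤ._- + (D * X)) (ℤ.pos-+ (D * ℓ) (D * X)) ⟨
    + (D * ℓ + D * X) ℤ.- + (D * X)
      ≤⟨ ℤ.+-monoˡ-≤ (ℤ.- + (D * X)) (ℤ.+≤+ h) ⟩
    + (m * ℓ * X) ℤ.- + (D * X)
      ≡⟨ cong₂ ℤ._-_ (trans (ℤ.pos-* (m * ℓ) X) (cong (ℤ._* + X) (ℤ.pos-* m ℓ))) (ℤ.pos-* D X) ⟩
    + m ℤ.* + ℓ ℤ.* + X ℤ.- + D ℤ.* + X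
      ≡⟨ factor (+ m) (+ ℓ) (+ D) (+ X) ⟩
    (+ m ℤ.* + ℓ ℤ.+ ℤ.- + 1 ℤ.* + D) ℤ.* + X ∎)
    where
    open ℤ.≤-Reasoning
    D ℓ X : ℕ
    D = suc D′
    ℓ = suc ℓ′
    X = suc X′
    x≡[x+y]-y : ∀ x y → x ≡ (x ℤ.+ y) ℤ.- y
    x≡[x+y]-y = ℤ-solve-∀
    factor : ∀ a b c d → a ℤ.* b ℤ.* d ℤ.- c ℤ.* d ≡ (a ℤ.* b ℤ.+ ℤ.- + 1 ℤ.* c) ℤ.* d
    factor = ℤ-solve-∀

  ratio-gap : ∀ m D ℓ X .{{_ : NonZero D}} .{{_ : NonZero ℓ}} .{{_ : NonZero X}} →
              D * ℓ + D * X ≤ m * ℓ * X → ¬ (ℚ.∣ + m ℚ./ D ℚ.- + 1 ℚ./ ℓ ∣ ℚ.< + 1 ℚ./ X)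
  ratio-gap m (suc D′) (suc ℓ′) (suc X′) h close =
    ℚ.<-irrefl refl (ℚ.≤-<-trans (subst (ε ℚ.≤_) (sym ∣r-L∣≡r-L) ε≤r-L) close)
    where
    r L ε : ℚ.ℚ
    r = + m ℚ./ suc D′
    L = + 1 ℚ./ suc ℓ′
    ε = + 1 ℚ./ suc X′
    r-L≃ : ℚ.toℚᵘ (r ℚ.- L) ℚᵘ.≃ ℚᵘ.mkℚᵘ (+ m) D′ ℚᵘ.- ℚᵘ.mkℚᵘ (+ 1) ℓ′
    r-L≃ = ℚᵘ.≃-trans (ℚ.toℚᵘ-homo-+ r (ℚ.- L))
             (ℚᵘ.+-cong (toℚᵘ-/ (+ m) (suc D′))
                        (ℚᵘ.≃-trans (ℚ.toℚᵘ-homo‿- L) (ℚᵘ.-‿cong (toℚᵘ-/ (+ 1) (suc ℓ′)))))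
    ε≤r-L : ε ℚ.≤ r ℚ.- L
    ε≤r-L = ℚ.toℚᵘ-cancel-≤ (ℚᵘ.≤-respˡ-≃ (ℚᵘ.≃-sym (toℚᵘ-/ (+ 1) (suc X′)))
                              (ℚᵘ.≤-respʳ-≃ (ℚᵘ.≃-sym r-L≃) (ℚᵘ-gap m D′ ℓ′ X′ h)))
    ∣r-L∣≡r-L : ℚ.∣ r ℚ.- L ∣ ≡ r ℚ.- L
    ∣r-L∣≡r-L = ℚ.0≤p⇒∣p∣≡p (ℚ.≤-trans (ℚ.<⇒≤ (0<1/n (suc X′))) ε≤r-L)

cover-gap : ∀ k t {ℓ m} .{{_ : NonZero k}} .{{_ : NonZero t}} → 2 ≤ ℓ →
  let T = 2 * (k * k) ; n = T * t in
  HasCover n k ℓ m → (T * T + 1) * n ^ k ≤ T * T * (n * (m * ℓ))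
cover-gap k t {ℓ} {m} 2≤ℓ (rooks , _ , covers) =
  gap-inequality k t (coverage-identity ∣D∣≡ℓ covered) m*ℓ≤crossPairs (crossPairs-bound t≤n)
  where
  n : ℕ
  n = 2 * (k * k) * t
  P : Fin m → Vec (Fin n) k
  P r = tabulate (pos (rooks r))
  D : Fin m → Subset k
  D r = dirs (rooks r)
  open Incidence P D

  ∣D∣≡ℓ : ∀ r → ∣ D r ∣ ≡ ℓ
  ∣D∣≡ℓ r = dirs-size (rooks r)

  t≤n : t ≤ n
  t≤n = m≤n*m t (2 * (k * k)) {{m*n≢0 2 (k * k) {{_}} {{m*n≢0 k k}}}}

  m*ℓ≤crossPairs : m * ℓ ≤ ∑≢ crossCount
  m*ℓ≤crossPairs = +-cancelʳ-≤ (m * ℓ) (m * ℓ) (∑≢ crossCount) (begin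
    m * ℓ + m * ℓ          ≡⟨ double m ℓ ⟩
    m * (ℓ * 2)            ≤⟨ *-monoʳ-≤ m (*-monoʳ-≤ ℓ 2≤ℓ) ⟩
    m * (ℓ * ℓ)            ≡⟨ crossPairs-identity ∣D∣≡ℓ ⟨
    ∑≢ crossCount + m * ℓ  ∎)
    where
    open ≤-Reasoning
    double : ∀ m ℓ → m * ℓ + m * ℓ ≡ m * (ℓ * 2)
    double = solve-∀

  on-own-line : ∀ r i Y → (∀ c → c ≢ i → pos (rooks r) c ≡ lookup Y c) → inFlat ⁅ i ⁆ (P r) Y ≡ true
  on-own-line r i Y agree = inFlat-line i (P r) Y (λ c c≢i → trans (lookup∘tabulate _ c) (agree c c≢i))

  covered : ∀ Y → 1 ≤ coverage Y
  covered Y with covers (lookup Y)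
  ... | r , inj₁ same =
    ≤-trans (≤-trans (s≤s z≤n) 2≤ℓ) (≤-trans (≤-reflexive own-square) (rookLines≤coverage r Y))
    where
    own-square : ℓ ≡ rookLines r Y
    own-square = begin
      ℓ
        ≡⟨ ∣D∣≡ℓ r ⟨
      ∣ D r ∣
        ≡⟨ ∣p∣≡∑𝟙 (D r) ⟩
      ∑[ i < k ] 𝟙 (lookup (D r) i)
        ≡⟨ sum-cong-≗ {k} (λ i → sym (*-identityʳ _)) ⟩
      ∑[ i < k ] (𝟙 (lookup (D r) i) * 1)
        ≡⟨ sum-cong-≗ {k} (λ i → cong (λ b → 𝟙 (lookup (D r) i) * 𝟙 b)
                                      (on-own-line r i Y (λ c _ → same c))) ⟨
      rookLines r Y ∎
      where open ≡-Reasoning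
  ... | r , inj₂ (i , i∈D , _ , agree) =
    ≤-trans line-i (≤-trans (term≤∑ (λ i → 𝟙 (lookup (D r) i) * 𝟙 (inFlat ⁅ i ⁆ (P r) Y)) i)
                            (rookLines≤coverage r Y))
    where
    line-i : 1 ≤ 𝟙 (lookup (D r) i) * 𝟙 (inFlat ⁅ i ⁆ (P r) Y)
    line-i rewrite []=⇒lookup i∈D | on-own-line r i Y agree = ≤-refl

subset-of-size : ∀ {k ℓ} → ℓ ≤ k → Σ (Subset k) (λ p → ∣ p ∣ ≡ ℓ)
subset-of-size {zero}  z≤n       = [] , refl
subset-of-size {suc k} z≤n       = let p , ∣p∣≡0 = subset-of-size {k} z≤n in false ∷ p , ∣p∣≡0
subset-of-size {suc k} (s≤s ℓ≤k) = let p , ∣p∣≡ℓ = subset-of-size ℓ≤k in true ∷ p , cong suc ∣p∣≡ℓ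

funToFin-cong : ∀ {k n} {f g : Fin k → Fin n} → (∀ c → f c ≡ g c) → funToFin f ≡ funToFin g
funToFin-cong {zero}  _   = refl
funToFin-cong {suc k} f≗g = cong₂ combine (f≗g zero) (funToFin-cong (λ c → f≗g (suc c)))

rook-on-every-point : ∀ n k {ℓ} → ℓ ≤ k → HasCover n k ℓ (n ^ k)
rook-on-every-point n k {ℓ} ℓ≤k = rooks , distinct , λ Q → funToFin Q , inj₁ (finToFun-funToFin Q)
  where
  rooks : Fin (n ^ k) → Rook n k ℓ
  rooks i = record
    { pos = finToFun i ; dirs = proj₁ (subset-of-size ℓ≤k) ; dirs-size = proj₂ (subset-of-size ℓ≤k) }
  distinct : ∀ i j → SamePoint (finToFun i) (finToFun j) → i ≡ j
  distinct i j same = begin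
    i                              ≡⟨ funToFin-finToFin {k} {n} i ⟨
    funToFin (finToFun {n} {k} i)  ≡⟨ funToFin-cong same ⟩
    funToFin (finToFun {n} {k} j)  ≡⟨ funToFin-finToFin {k} {n} j ⟩
    j                              ∎
    where open ≡-Reasoning

-- HasCover is not decidable, so a least cover size exists only up to double negation.
¬¬-minimal : ∀ (Q : ℕ → Set) {M} → Q M → ¬ ¬ Σ ℕ (λ m → Q m × (∀ m′ → m′ < m → ¬ Q m′))
¬¬-minimal Q {M} QM no-minimal = none-below (suc M) M ≤-refl QM
  where
  none-below : ∀ B x → x < B → ¬ Q x
  none-below (suc B) x (s≤s x≤B) Qx =
    no-minimal (x , Qx , λ m′ m′<x → none-below B m′ (≤-trans m′<x x≤B))

-- n = T·(t+1) is a successor, so ratio (pred n) is the ratio at n itself.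
min-cover-ratio-gap : ∀ k′ t {ℓ m} → 2 ≤ ℓ →
  let k = suc k′ ; T = 2 * (k * k) ; n = T * suc t in
  IsMinCover n k ℓ m → ¬ (ℚ.∣ ratio (pred n) k m ℚ.- oneOver ℓ ∣ ℚ.< oneOver (T * T * ℓ))
min-cover-ratio-gap k′ t {ℓ@(suc ℓ′)} {m} 2≤ℓ (cover , _) =
  ratio-gap m D ℓ X {{m^n≢0 n k′}} (subst₂ _≤_ (rearrangeˡ T D ℓ) (rearrangeʳ T m ℓ) (*-monoʳ-≤ ℓ gap))
  where
  k T n D X : ℕ
  k = suc k′
  T = 2 * (k * k)
  n = T * suc t
  D = n ^ k′
  X = T * T * ℓ
  gap : (T * T + 1) * D ≤ T * T * (m * ℓ)
  gap = *-cancelˡ-≤ n (subst₂ _≤_ (x∙yz≈y∙xz (T * T + 1) n D) (x∙yz≈y∙xz (T * T) n (m * ℓ))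
                                  (cover-gap k (suc t) 2≤ℓ cover))
  rearrangeˡ : ∀ T D ℓ → ℓ * ((T * T + 1) * D) ≡ D * ℓ + D * (T * T * ℓ)
  rearrangeˡ = solve-∀
  rearrangeʳ : ∀ T m ℓ → ℓ * (T * T * (m * ℓ)) ≡ m * ℓ * (T * T * ℓ)
  rearrangeʳ = solve-∀

corollary10 : ∀ (k ℓ : ℕ) → 2 ≤ ℓ → ℓ ≤ k → ¬ ConvergesTo k ℓ (oneOver ℓ)
corollary10 (suc k′) ℓ@(suc _) 2≤ℓ ℓ≤k converges =
  ¬¬-minimal (HasCover n k ℓ) (rook-on-every-point n k ℓ≤k)
    (λ (m , minimal) → min-cover-ratio-gap k′ N 2≤ℓ minimal (close (pred n) N≤n m minimal))
  where
  k T X : ℕ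
  k = suc k′
  T = 2 * (k * k)
  X = T * T * ℓ
  N : ℕ
  N = proj₁ (converges (oneOver X) (0<1/n X))
  close : ∀ n′ → suc n′ ≥ N → ∀ m → IsMinCover (suc n′) k ℓ m →
          ℚ.∣ ratio n′ k m ℚ.- oneOver ℓ ∣ ℚ.< oneOver X
  close = proj₂ (converges (oneOver X) (0<1/n X))
  n : ℕ
  n = T * suc N
  N≤n : N ≤ n
  N≤n = ≤-trans (n≤1+n N) (m≤n*m (suc N) T)
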